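{- Let $g\ge3$ and $2\le k<g$ be integers, and let $N=\sum_{i=0}^{n-1}a_ig^i$ (digits $0\le a_i<g$, $a_{n-1}\ne0$) be a $(g,k)$-reverse multiple. Then $a_0+a_{n-1}\le g$. Moreover, if $a_0+a_{n-1}=g$, then $k+1$ divides $g$.
   Context: A positive integer $N=\sum_{i=0}^{n-1}a_ig^i$ with base-$g$ digits $0\le a_i<g$ and $a_{n-1}\ne 0$ is a $(g,k)$-reverse multiple if $kN=\sum_{i=0}^{n-1}a_{n-1-i}g^i$, i.e. $k$ times $N$ equals the number whose base-$g$ digit string is that of $N$ reversed. -}

module Defs where

open import Data.Nat using (ℕ; zero; suc; _+_; _*_; _∸_; _^_; _<_)
open import Data.Product using (_×_)
open import Relation.Binary.PropositionalEquality using (_≡_; _≢_)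

digitSum : ℕ → (n : ℕ) → (ℕ → ℕ) → ℕ
digitSum g zero    a = 0
digitSum g (suc n) a = digitSum g n a + a n * g ^ n

revDigits : ℕ → (ℕ → ℕ) → ℕ → ℕ
revDigits n a i = a (n ∸ 1 ∸ i)

ValidDigits : ℕ → (n : ℕ) → (ℕ → ℕ) → Set
ValidDigits g n a = (∀ i → i < n → a i < g) × (a (n ∸ 1) ≢ 0)

IsReverseMultiple : (g k n : ℕ) → (ℕ → ℕ) → Set
IsReverseMultiple g k n a = k * digitSum g n a ≡ digitSum g n (revDigits n a)

module Submission where

open import Defs
open import Data.Nat using (ℕ; suc; _+_; _≤_; _<_; _∸_)
open import Data.Nat.Divisibility using (_∣_)
open import Data.Product using (_×_)
open import Relation.Binary.PropositionalEquality using (_≡_)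

open import Data.Nat using (zero; _*_; _^_; _%_; _/_; z≤n; s≤s; NonZero; ≢-nonZero; >-nonZero)
open import Data.Nat.Properties
open import Data.Nat.DivMod using (m≡m%n+[m/n]*n; [m+kn]%n≡m%n; m<n⇒m%n≡m; %-distribˡ-*)
open import Data.Nat.Divisibility using (m∣m*n)
open import Data.Product using (_,_)
open import Relation.Binary.PropositionalEquality
  using (sym; trans; cong; subst; module ≡-Reasoning)
open import Relation.Nullary using (contradiction)

-- Comparing leading digits shows k a₋ ≤ a₀ (writing a₋ = a_{n-1}), and reducing
-- mod g shows k a₀ = a₋ + M g for some carry M. From a₀ < g the carry is below k,
-- and k (a₀ + a₋) ≤ k a₀ + a₀ = a₋ + M g + a₀ gives (k - 1)(a₀ + a₋) ≤ M g ≤ (k - 1) g.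
-- If a₀ + a₋ = g, then M = k - 1 and k g = k a₀ + k a₋ = (k + 1) a₋ + (k - 1) g,
-- so g = (k + 1) a₋.

digitSum<g^n : ∀ g n (a : ℕ → ℕ) → (∀ i → i < n → a i < g) → digitSum g n a < g ^ n
digitSum<g^n g zero    a digits = s≤s z≤n
digitSum<g^n g (suc n) a digits = begin-strict
  digitSum g n a + a n * g ^ n   <⟨ +-monoˡ-< (a n * g ^ n) lower<g^n ⟩
  g ^ n + a n * g ^ n            ≤⟨ *-monoˡ-≤ (g ^ n) (digits n (n<1+n n)) ⟩
  g * g ^ n                      ∎
  where
  open ≤-Reasoning
  lower<g^n : digitSum g n a < g ^ n
  lower<g^n = digitSum<g^n g n a (λ i i<n → digits i (m<n⇒m<1+n i<n))

digitSum%g : ∀ g .{{_ : NonZero g}} m (a : ℕ → ℕ) → digitSum g (suc m) a % g ≡ a 0 % g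
digitSum%g g zero    a = cong (_% g) (*-identityʳ (a 0))
digitSum%g g (suc m) a = begin
  (digitSum g (suc m) a + a (suc m) * (g * g ^ m)) % g
    ≡⟨ cong (λ x → (digitSum g (suc m) a + x) % g) (*-comm (a (suc m)) (g * g ^ m)) ⟩
  (digitSum g (suc m) a + g * g ^ m * a (suc m)) % g
    ≡⟨ cong (λ x → (digitSum g (suc m) a + x) % g) (*-assoc g (g ^ m) (a (suc m))) ⟩
  (digitSum g (suc m) a + g * (g ^ m * a (suc m))) % g
    ≡⟨ cong (λ x → (digitSum g (suc m) a + x) % g) (*-comm g (g ^ m * a (suc m))) ⟩
  (digitSum g (suc m) a + g ^ m * a (suc m) * g) % g
    ≡⟨ [m+kn]%n≡m%n (digitSum g (suc m) a) (g ^ m * a (suc m)) g ⟩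
  digitSum g (suc m) a % g
    ≡⟨ digitSum%g g m a ⟩
  a 0 % g ∎
  where open ≡-Reasoning

leadingDigit-≤ : ∀ g k m (a c : ℕ → ℕ) → (∀ i → i < m → c i < g) →
  k * digitSum g (suc m) a ≤ digitSum g (suc m) c → k * a m ≤ c m
leadingDigit-≤ g k m a c digits ≤c with *-cancelʳ-< (g ^ m) (k * a m) (suc (c m)) kaₘ<
  where
  open ≤-Reasoning
  kaₘ< : k * a m * g ^ m < suc (c m) * g ^ m
  kaₘ< = begin-strict
    k * a m * g ^ m               ≡⟨ *-assoc k (a m) (g ^ m) ⟩
    k * (a m * g ^ m)             ≤⟨ *-monoʳ-≤ k (m≤n+m (a m * g ^ m) (digitSum g m a)) ⟩
    k * digitSum g (suc m) a      ≤⟨ ≤c ⟩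
    digitSum g m c + c m * g ^ m  <⟨ +-monoˡ-< (c m * g ^ m) (digitSum<g^n g m c digits) ⟩
    suc (c m) * g ^ m             ∎
... | s≤s kaₘ≤cₘ = kaₘ≤cₘ

lastDigit-% : ∀ g .{{_ : NonZero g}} k m (a c : ℕ → ℕ) →
  k * digitSum g (suc m) a ≡ digitSum g (suc m) c → (k * a 0) % g ≡ c 0 % g
lastDigit-% g k m a c eq = begin
  (k * a 0) % g                              ≡⟨ %-distribˡ-* k (a 0) g ⟩
  (k % g * (a 0 % g)) % g                    ≡⟨ cong (λ x → (k % g * x) % g) (digitSum%g g m a) ⟨
  (k % g * (digitSum g (suc m) a % g)) % g   ≡⟨ %-distribˡ-* k (digitSum g (suc m) a) g ⟨
  (k * digitSum g (suc m) a) % g             ≡⟨ cong (_% g) eq ⟩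
  digitSum g (suc m) c % g                   ≡⟨ digitSum%g g m c ⟩
  c 0 % g                                    ∎
  where open ≡-Reasoning

reverseMultiple-leadingDigit : ∀ g k m (a : ℕ → ℕ) → ValidDigits g (suc m) a →
  IsReverseMultiple g k (suc m) a → k * a m ≤ a 0
reverseMultiple-leadingDigit g k m a (digits , _) rm =
  subst (k * a m ≤_) (cong a (n∸n≡0 m))
    (leadingDigit-≤ g k m a (revDigits (suc m) a)
      (λ i _ → digits (m ∸ i) (s≤s (m∸n≤m m i))) (≤-reflexive rm))

reverseMultiple-lastDigit : ∀ g .{{_ : NonZero g}} k m (a : ℕ → ℕ) → ValidDigits g (suc m) a →
  IsReverseMultiple g k (suc m) a → (k * a 0) % g ≡ a m
reverseMultiple-lastDigit g k m a (digits , _) rm =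
  trans (lastDigit-% g k m a (revDigits (suc m) a) rm) (m<n⇒m%n≡m (digits m (n<1+n m)))

-- Here k = suc j with j ≠ 0, and M is the carry produced by the last digit of k N.
module _ (j : ℕ) .{{_ : NonZero j}} (a b g M : ℕ)
         (kb≤a : suc j * b ≤ a) (a<g : a < g) (carry : suc j * a ≡ b + M * g) where

  carry≤j : M ≤ j
  carry≤j with *-cancelʳ-< g M (suc j) Mg<
    where
    Mg< : M * g < suc j * g
    Mg< = ≤-<-trans (subst (M * g ≤_) (sym carry) (m≤n+m (M * g) b)) (*-monoʳ-< (suc j) a<g)
  ... | s≤s M≤j = M≤j

  j*[a+b]≤M*g : j * (a + b) ≤ M * g
  j*[a+b]≤M*g = +-cancelʳ-≤ (a + b) (j * (a + b)) (M * g) (begin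
    j * (a + b) + (a + b)  ≡⟨ +-comm (j * (a + b)) (a + b) ⟩
    suc j * (a + b)        ≡⟨ *-distribˡ-+ (suc j) a b ⟩
    suc j * a + suc j * b  ≤⟨ +-monoʳ-≤ (suc j * a) kb≤a ⟩
    suc j * a + a          ≡⟨ cong (_+ a) carry ⟩
    b + M * g + a          ≡⟨ +-comm (b + M * g) a ⟩
    a + (b + M * g)        ≡⟨ +-assoc a b (M * g) ⟨
    a + b + M * g          ≡⟨ +-comm (a + b) (M * g) ⟩
    M * g + (a + b)        ∎)
    where open ≤-Reasoning

  endDigits-sum≤ : a + b ≤ g
  endDigits-sum≤ = *-cancelˡ-≤ j (≤-trans j*[a+b]≤M*g (*-monoˡ-≤ g carry≤j))

  endDigits-sum≡⇒∣ : a + b ≡ g → suc (suc j) ∣ g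
  endDigits-sum≡⇒∣ a+b≡g = subst (suc (suc j) ∣_) (sym g≡[2+j]*b) (m∣m*n b)
    where
    M≡j : M ≡ j
    M≡j = ≤-antisym carry≤j
      (*-cancelʳ-≤ j M g {{>-nonZero (≤-trans (s≤s z≤n) a<g)}} (subst (λ s → j * s ≤ M * g) a+b≡g j*[a+b]≤M*g))
    open ≡-Reasoning
    g≡[2+j]*b : g ≡ suc (suc j) * b
    g≡[2+j]*b = +-cancelʳ-≡ (j * g) g (suc (suc j) * b) (begin
      suc j * g                ≡⟨ cong (suc j *_) a+b≡g ⟨
      suc j * (a + b)          ≡⟨ *-distribˡ-+ (suc j) a b ⟩
      suc j * a + suc j * b    ≡⟨ cong (λ x → x + suc j * b) carry ⟩
      b + M * g + suc j * b    ≡⟨ cong (λ x → b + x * g + suc j * b) M≡j ⟩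
      b + j * g + suc j * b    ≡⟨ +-assoc b (j * g) (suc j * b) ⟩
      b + (j * g + suc j * b)  ≡⟨ cong (b +_) (+-comm (j * g) (suc j * b)) ⟩
      b + (suc j * b + j * g)  ≡⟨ +-assoc b (suc j * b) (j * g) ⟨
      suc (suc j) * b + j * g  ∎)

theorem4 : (g k n : ℕ) (a : ℕ → ℕ) →
    3 ≤ g → 2 ≤ k → k < g → 1 ≤ n →
    ValidDigits g n a →
    IsReverseMultiple g k n a →
    (a 0 + a (n ∸ 1) ≤ g) × (a 0 + a (n ∸ 1) ≡ g → suc k ∣ g)
theorem4 g k (suc zero) a _ (s≤s (s≤s _)) _ _ valid@(_ , a₀≢0) rm = contradiction k≤1 λ { (s≤s ()) }
  where
  k≤1 : k ≤ 1
  k≤1 = *-cancelʳ-≤ k 1 (a 0) {{≢-nonZero a₀≢0}}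
    (subst (k * a 0 ≤_) (sym (*-identityˡ (a 0))) (reverseMultiple-leadingDigit g k 0 a valid rm))
theorem4 g@(suc _) k@(suc j) (suc m@(suc _)) a _ (s≤s (s≤s _)) _ _ valid@(digits , _) rm =
  endDigits-sum≤ j (a 0) (a m) g M kaₘ≤a₀ a₀<g carry , endDigits-sum≡⇒∣ j (a 0) (a m) g M kaₘ≤a₀ a₀<g carry
  where
  kaₘ≤a₀ : k * a m ≤ a 0
  kaₘ≤a₀ = reverseMultiple-leadingDigit g k m a valid rm
  a₀<g : a 0 < g
  a₀<g = digits 0 (s≤s z≤n)
  M : ℕ
  M = (k * a 0) / g
  carry : k * a 0 ≡ a m + M * g
  carry = trans (m≡m%n+[m/n]*n (k * a 0) g)
            (cong (_+ M * g) (reverseMultiple-lastDigit g k m a valid rm))
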